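{- Let $(\Sigma_d,\Sigma_s,R_d,R_s)$ be a stream specification with $R_d=\emptyset$ such that every $f\in\Sigma_s$ has a type of the form $d^n\times s^m\to s$ with $n\in\mathbb{N}$ and $m\in\{0,1\}$. Then every infinite outermost reduction $t_0\to t_1\to t_2\to\cdots$ with respect to $R_s\cup\{x:\sigma\to\mathsf{overflow}\}$ (or with respect to $R_s$) is balanced.
   Context: Terms are many-sorted with two sorts, $s$ (streams) and $d$ (data). $\Sigma_d$ is a signature of symbols of type $d^n \to d$ ($n\ge 0$), and $R_d$ is a terminating orthogonal rewrite system over $\Sigma_d$; the set $D$ of data elements is the set of (unique) $R_d$-normal forms of ground terms over $\Sigma_d$. $\Sigma_s$ is a set of stream symbols, each of type $d^n\times s^m\to s$ ($n,m\ge 0$), and $:$ is a distinguished symbol not in $\Sigma_s$ of type $d\times s\to s$ (written infix). A stream specification $(\Sigma_d,\Sigma_s,R_d,R_s)$ consists of these data together with a set $R_s$ of rewrite rules over $\Sigma_d\cup\Sigma_s\cup\{:\}$, each of the form $f(u_1,\dots,u_n,t_1,\dots,t_m)\to t$, where: $f\in\Sigma_s$ has type $d^n\times s^m\to s$; each $t_i$ is either a variable of sort $s$ or of the form $x:\sigma$ with $x$ a variable of sort $d$ and $\sigma$ a variable of sort $s$; $t$ is any well-sorted term of sort $s$; $R_s\cup R_d$ is orthogonal; and every term $f(u_1,\dots,u_n,u_{n+1}:t_1,\dots,u_{n+m}:t_m)$ with $f\in\Sigma_s$ of type $d^n\times s^m\to s$ and $u_1,\dots,u_{n+m}\in D$ matches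 the left-hand side of some rule of $R_s$. $\mathsf{overflow}$ is a fresh constant of sort $s$. A rewrite step $t\to_p t'$ (contracting a redex at position $p$) is outermost if $t$ has no redex at any proper prefix of $p$. An infinite outermost reduction $t_1\to_{p_1}t_2\to_{p_2}\cdots$ is balanced if for every $i$ and every position $q$ at which $t_i$ has a redex there exists $j\ge i$ with $p_j$ a prefix of $q$. -}

module Defs where

open import Data.Nat using (ℕ; zero; suc; _+_; _≤_)
open import Data.Fin using (Fin; toℕ)
open import Data.Vec using (Vec; []; _∷_; lookup; _[_]≔_; zipWith)
open import Data.Vec.Relation.Unary.All using (All)
open import Data.List using (List; []; _∷_; _++_)
open import Data.List.Membership.Propositional using (_∈_)
open import Data.List.Relation.Unary.Unique.Propositional using (Unique)
open import Data.Product using (Σ; ∃; ∃-syntax; _×_; _,_)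
open import Data.Sum using (_⊎_; inj₁; inj₂)
open import Data.Unit using (⊤; tt)
open import Relation.Nullary using (¬_)
open import Relation.Binary.PropositionalEquality using (_≡_; _≢_)

data Sort : Set where
  d s : Sort

-- The stream constructor _:_ and the constant overflow are built into the
-- term syntax below and are distinct from all symbols of Σ_d and Σ_s.

record StreamSig : Set₁ where
  field
    DSym   : Set
    darity : DSym → ℕ
    SSym   : Set
    dArity : SSym → ℕ
    sArity : SSym → ℕ

module Terms (Sig : StreamSig) where
  open StreamSig Sig

  -- Well-sorted terms.  Variables: a variable of sort σ is a natural
  -- number (variables of different sorts are different).
  data Term : Sort → Set where
    var      : ∀ {σ} → ℕ → Term σ
    dapp     : (f : DSym) → Vec (Term d) (darity f) → Term d
    sapp     : (f : SSym) → Vec (Term d) (dArity f) → Vec (Term s) (sArity f) → Term s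
    _∷ₛ_     : Term d → Term s → Term s
    overflow : Term s

  infixr 5 _∷ₛ_

  Subst : Set
  Subst = (σ : Sort) → ℕ → Term σ

  mutual
    _⟨_⟩ : ∀ {σ} → Term σ → Subst → Term σ
    _⟨_⟩ {σ} (var x) θ = θ σ x
    dapp f ts    ⟨ θ ⟩ = dapp f (substs ts θ)
    sapp f us ts ⟨ θ ⟩ = sapp f (substs us θ) (substs ts θ)
    (u ∷ₛ t)     ⟨ θ ⟩ = (u ⟨ θ ⟩) ∷ₛ (t ⟨ θ ⟩)
    overflow     ⟨ θ ⟩ = overflow

    substs : ∀ {σ n} → Vec (Term σ) n → Subst → Vec (Term σ) n
    substs []       θ = []
    substs (t ∷ ts) θ = (t ⟨ θ ⟩) ∷ substs ts θ

  mutual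
    vars : ∀ {σ} → Term σ → List (Sort × ℕ)
    vars {σ} (var x) = (σ , x) ∷ []
    vars (dapp f ts)    = varsV ts
    vars (sapp f us ts) = varsV us ++ varsV ts
    vars (u ∷ₛ t)       = vars u ++ vars t
    vars overflow       = []

    varsV : ∀ {σ n} → Vec (Term σ) n → List (Sort × ℕ)
    varsV []       = []
    varsV (t ∷ ts) = vars t ++ varsV ts

  IsVar : ∀ {σ} → Term σ → Set
  IsVar {σ} t = ∃[ x ] (t ≡ var x)

  -- Ground data terms over Σ_d.  Since R_d = ∅, these are exactly the
  -- data elements D (every ground term is an R_d-normal form).
  data GroundData : Term d → Set where
    dapp : ∀ {f ts} → All GroundData ts → GroundData (dapp f ts)

  -- Positions: lists of argument indices (0-based).  The arguments of
  -- sapp f us ts are numbered us first (0..n-1), then ts (n..n+m-1);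
  -- those of u ∷ₛ t are 0 (u) and 1 (t).

  Pos : Set
  Pos = List ℕ

  _≼_ : Pos → Pos → Set
  p ≼ q = ∃[ r ] (p ++ r ≡ q)

  _≺_ : Pos → Pos → Set
  p ≺ q = ∃[ i ] ∃[ r ] (p ++ (i ∷ r) ≡ q)

  data SubAt {τ : Sort} (u : Term τ) : ∀ {σ} → Pos → Term σ → Set where
    here  : SubAt u [] u
    dargᵢ : ∀ {f ts p} (i : Fin (darity f)) → SubAt u p (lookup ts i) →
            SubAt u (toℕ i ∷ p) (dapp f ts)
    sdargᵢ : ∀ {f us ts p} (i : Fin (dArity f)) → SubAt u p (lookup us i) →
            SubAt u (toℕ i ∷ p) (sapp f us ts)
    ssargᵢ : ∀ {f us ts p} (i : Fin (sArity f)) → SubAt u p (lookup ts i) →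
            SubAt u ((dArity f + toℕ i) ∷ p) (sapp f us ts)
    hd    : ∀ {h t p} → SubAt u p h → SubAt u (0 ∷ p) (h ∷ₛ t)
    tl    : ∀ {h t p} → SubAt u p t → SubAt u (1 ∷ p) (h ∷ₛ t)

  record TRS : Set₁ where
    field
      Rule : Set
      lhs  : Rule → Term s
      rhs  : Rule → Term s

  module _ (R : TRS) where
    open TRS R

    data RedexAt : ∀ {σ} → Pos → Term σ → Set where
      root  : ∀ {t} (r : Rule) (θ : Subst) → lhs r ⟨ θ ⟩ ≡ t → RedexAt [] t
      dargᵢ : ∀ {f ts p} (i : Fin (darity f)) → RedexAt p (lookup ts i) →
              RedexAt (toℕ i ∷ p) (dapp f ts)
      sdargᵢ : ∀ {f us ts p} (i : Fin (dArity f)) → RedexAt p (lookup us i) →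
              RedexAt (toℕ i ∷ p) (sapp f us ts)
      ssargᵢ : ∀ {f us ts p} (i : Fin (sArity f)) → RedexAt p (lookup ts i) →
              RedexAt ((dArity f + toℕ i) ∷ p) (sapp f us ts)
      hd    : ∀ {h t p} → RedexAt p h → RedexAt (0 ∷ p) (h ∷ₛ t)
      tl    : ∀ {h t p} → RedexAt p t → RedexAt (1 ∷ p) (h ∷ₛ t)

    data Step : ∀ {σ} → Pos → Term σ → Term σ → Set where
      root  : ∀ {t t'} (r : Rule) (θ : Subst) →
              lhs r ⟨ θ ⟩ ≡ t → rhs r ⟨ θ ⟩ ≡ t' → Step [] t t'
      dargᵢ : ∀ {f ts p u} (i : Fin (darity f)) → Step p (lookup ts i) u →
              Step (toℕ i ∷ p) (dapp f ts) (dapp f (ts [ i ]≔ u))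
      sdargᵢ : ∀ {f us ts p u} (i : Fin (dArity f)) → Step p (lookup us i) u →
              Step (toℕ i ∷ p) (sapp f us ts) (sapp f (us [ i ]≔ u) ts)
      ssargᵢ : ∀ {f us ts p u} (i : Fin (sArity f)) → Step p (lookup ts i) u →
              Step ((dArity f + toℕ i) ∷ p) (sapp f us ts) (sapp f us (ts [ i ]≔ u))
      hd    : ∀ {h t p u} → Step p h u → Step (0 ∷ p) (h ∷ₛ t) (u ∷ₛ t)
      tl    : ∀ {h t p u} → Step p t u → Step (1 ∷ p) (h ∷ₛ t) (h ∷ₛ u)

    OutermostStep : ∀ {σ} → Pos → Term σ → Term σ → Set
    OutermostStep p t t' = Step p t t' × (∀ q → q ≺ p → ¬ RedexAt q t)

    record OutermostReduction (σ : Sort) : Set where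
      field
        term  : ℕ → Term σ
        pos   : ℕ → Pos
        steps : ∀ i → OutermostStep (pos i) (term i) (term (suc i))

    Balanced : ∀ {σ} → OutermostReduction σ → Set
    Balanced red = ∀ i q → RedexAt q (term i) → ∃[ j ] (i ≤ j × pos j ≼ q)
      where open OutermostReduction red

  overflowRule : TRS → TRS
  overflowRule R = record
    { Rule = Rule ⊎ ⊤
    ; lhs  = λ { (inj₁ r) → lhs r ; (inj₂ _) → var 0 ∷ₛ var 0 }
    ; rhs  = λ { (inj₁ r) → rhs r ; (inj₂ _) → overflow }
    }
    where open TRS R

  module _ (R : TRS) where
    open TRS R

    StreamPat : Term s → Set
    StreamPat t = IsVar t ⊎ ∃[ x ] ∃[ y ] (t ≡ var x ∷ₛ var y)

    LhsShape : Term s → Set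
    LhsShape l = ∃[ f ] ∃[ us ] ∃[ ts ] (l ≡ sapp f us ts × All StreamPat ts)

    LeftLinear : Set
    LeftLinear = ∀ r → Unique (vars (lhs r))

    VarCond : Set
    VarCond = ∀ r x → x ∈ vars (rhs r) → x ∈ vars (lhs r)

    -- no overlaps: no non-variable subterm of lhs r₁ at p (p ≠ ε when
    -- r₁ = r₂) unifies with lhs r₂ (rules renamed apart, hence two
    -- independent substitutions)
    NonOverlapping : Set
    NonOverlapping = ∀ r₁ r₂ (p : Pos) (u : Term s) → SubAt u p (lhs r₁) →
      ¬ IsVar u → (r₁ ≡ r₂ → p ≢ []) →
      ∀ (θ₁ θ₂ : Subst) → u ⟨ θ₁ ⟩ ≢ lhs r₂ ⟨ θ₂ ⟩

    Orthogonal : Set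
    Orthogonal = LeftLinear × NonOverlapping

    Exhaustive : Set
    Exhaustive = ∀ f (us : Vec (Term d) (dArity f)) (hs : Vec (Term d) (sArity f))
      (ts : Vec (Term s) (sArity f)) → All GroundData us → All GroundData hs →
      ∃[ r ] ∃[ θ ] (lhs r ⟨ θ ⟩ ≡ sapp f us (zipWith _∷ₛ_ hs ts))

    IsStreamSpec : Set
    IsStreamSpec = (∀ r → LhsShape (lhs r)) × VarCond × Orthogonal × Exhaustive

-- Rules have sort s and R_d = ∅, so data subterms contain no redexes.  When
-- every stream symbol has at most one stream argument, the stream positions of
-- a term form a single path, so any two redex positions are comparable.  An
-- outermost step therefore contracts a redex at a prefix of every redex
-- position of the term, and each redex is dealt with at once (j = i).
module Submission where

open import Defs
open import Data.Nat using (_≤_; z≤n; s≤s)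
open import Data.Nat.Properties using (≤-refl)
open import Data.Fin using (Fin; zero)
open import Data.List using (_∷_)
open import Data.Product using (_×_; _,_)
open import Data.Sum using (_⊎_; inj₁; inj₂)
open import Data.Empty using (⊥-elim)
open import Relation.Nullary using (¬_)
open import Relation.Binary.PropositionalEquality using (_≡_; refl; cong)

Fin≤1-irrelevant : ∀ {n} → n ≤ 1 → (i j : Fin n) → i ≡ j
Fin≤1-irrelevant (s≤s z≤n) zero zero = refl

module Balance (Sig : StreamSig) (R : Terms.TRS Sig) where
  open StreamSig Sig
  open Terms Sig

  data-irreducible : ∀ {p} {t : Term d} → ¬ RedexAt R p t
  data-irreducible (dargᵢ i r) = data-irreducible r

  Step⇒RedexAt : ∀ {σ p} {t t′ : Term σ} → Step R p t t′ → RedexAt R p t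
  Step⇒RedexAt (root r θ l≡t _) = root r θ l≡t
  Step⇒RedexAt (dargᵢ i st)     = dargᵢ i (Step⇒RedexAt st)
  Step⇒RedexAt (sdargᵢ i st)    = sdargᵢ i (Step⇒RedexAt st)
  Step⇒RedexAt (ssargᵢ i st)    = ssargᵢ i (Step⇒RedexAt st)
  Step⇒RedexAt (hd st)          = hd (Step⇒RedexAt st)
  Step⇒RedexAt (tl st)          = tl (Step⇒RedexAt st)

  Comparable : Pos → Pos → Set
  Comparable p q = p ≼ q ⊎ q ≺ p

  ∷-comparable : ∀ k {p q} → Comparable p q → Comparable (k ∷ p) (k ∷ q)
  ∷-comparable k (inj₁ (r , p++r≡q))     = inj₁ (r , cong (k ∷_) p++r≡q)
  ∷-comparable k (inj₂ (i , r , q++r≡p)) = inj₂ (i , r , cong (k ∷_) q++r≡p)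

  module _ (unary : ∀ f → sArity f ≤ 1) where

    redexes-comparable : ∀ {p q} {t : Term s} →
      RedexAt R p t → RedexAt R q t → Comparable p q
    redexes-comparable {q = q} (root _ _ _)       _                  = inj₁ (q , refl)
    redexes-comparable {p = k ∷ p} (ssargᵢ _ _)   (root _ _ _)       = inj₂ (k , p , refl)
    redexes-comparable {p = k ∷ p} (tl _)         (root _ _ _)       = inj₂ (k , p , refl)
    redexes-comparable (ssargᵢ {f = f} i r) (ssargᵢ j r′)
      with Fin≤1-irrelevant (unary f) i j
    ... | refl = ∷-comparable _ (redexes-comparable r r′)
    redexes-comparable (tl r)               (tl r′)      = ∷-comparable 1 (redexes-comparable r r′)
    redexes-comparable (sdargᵢ _ r)         _            = ⊥-elim (data-irreducible r)
    redexes-comparable (hd r)               _            = ⊥-elim (data-irreducible r)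
    redexes-comparable (ssargᵢ _ _)         (sdargᵢ _ r) = ⊥-elim (data-irreducible r)
    redexes-comparable (tl _)               (hd r)       = ⊥-elim (data-irreducible r)

    outermost-prefix-of-redex : ∀ {σ p q} {t t′ : Term σ} →
      OutermostStep R p t t′ → RedexAt R q t → p ≼ q
    outermost-prefix-of-redex {d} _ r = ⊥-elim (data-irreducible r)
    outermost-prefix-of-redex {s} (st , outermost) r
      with redexes-comparable (Step⇒RedexAt st) r
    ... | inj₁ p≼q = p≼q
    ... | inj₂ q≺p = ⊥-elim (outermost _ q≺p r)

    outermost-balanced : ∀ {σ} (red : OutermostReduction R σ) → Balanced R red
    outermost-balanced red i q r =
      i , ≤-refl , outermost-prefix-of-redex (OutermostReduction.steps red i) r

open StreamSig
open Terms

proposition14 : (Sig : StreamSig) (Rₛ : TRS Sig) → IsStreamSpec Sig Rₛ →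
    (∀ f → sArity Sig f ≤ 1) →
    (∀ {σ} (red : OutermostReduction Sig (overflowRule Sig Rₛ) σ) → Balanced Sig (overflowRule Sig Rₛ) red)
    × (∀ {σ} (red : OutermostReduction Sig Rₛ σ) → Balanced Sig Rₛ red)
proposition14 Sig Rₛ _ unary =
  Balance.outermost-balanced Sig (overflowRule Sig Rₛ) unary ,
  Balance.outermost-balanced Sig Rₛ unary
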